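{- For every integer $n\ge 2$, $$\tau(n)=\left\lfloor\frac{n-1}{2}\right\rfloor+\tau\!\left(\left\lfloor\frac{n}{2}\right\rfloor\right),$$ and for every positive integer $n$, $$\tau(n)=\sum_{j\ge 1}\left\lfloor\frac{n-2^{j-1}}{2^j}\right\rfloor = n-1-\lfloor \log_2 n\rfloor.$$
   Context: Multi-pass stack sorting: in a pass, the entries of the current input are pushed one at a time, in order, onto a stack; whenever the top of the stack is the smallest value not yet output, it is popped to the output (repeatedly); entries are never popped otherwise. When all input entries have been pushed and no pop is possible, if the stack is nonempty the remaining entries are returned to the input in their original relative order and a new pass begins. The tier $t(\sigma)$ of a permutation $\sigma$ is one less than the minimum number of passes needed to output $1,\dots,n$. For a positive integer $n$, $\tau(n)$ denotes the maximum of $t(\sigma)$ over all permutations $\sigma$ of length $n$. -}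

module Defs where

open import Data.Nat using (ℕ; zero; suc; _+_; _*_; _∸_; _^_; _≤_; _<_)
open import Data.Nat.Properties using (_≟_; m^n≢0)
open import Data.Nat.DivMod using (_/_)
open import Data.List using (List; []; _∷_; reverse; map; upTo; sum)
open import Data.List.Relation.Binary.Permutation.Propositional using (_↭_)
open import Data.Product using (_×_; _,_; proj₂)
open import Relation.Nullary using (¬_; yes; no)
open import Relation.Binary.PropositionalEquality using (_≡_)

-- A stack is a list with its top first.
-- popAll k s : repeatedly pop the top while it equals k, the smallest value
-- not yet output; returns the new "smallest not yet output" and the stack.
popAll : ℕ → List ℕ → ℕ × List ℕ
popAll k [] = k , []
popAll k (x ∷ s) with x ≟ k
... | yes _ = popAll (suc k) s
... | no _  = k , x ∷ s

-- At the end the remaining stack entries are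
-- returned to the input in their original relative order (bottom-to-top of
-- the stack = reverse of the top-first list).
passGo : ℕ → List ℕ → List ℕ → ℕ × List ℕ
passGo k s [] = k , reverse s
passGo k s (x ∷ xs) with popAll k (x ∷ s)
... | k' , s' = passGo k' s' xs

pass : ℕ × List ℕ → ℕ × List ℕ
pass (k , xs) = passGo k [] xs

afterPasses : ℕ → List ℕ → ℕ × List ℕ
afterPasses zero σ = 1 , σ
afterPasses (suc m) σ = pass (afterPasses m σ)

leftAfter : ℕ → List ℕ → List ℕ
leftAfter m σ = proj₂ (afterPasses m σ)

IsPerm : ℕ → List ℕ → Set
IsPerm n σ = σ ↭ map suc (upTo n)

-- Tier t σ holds iff the minimum number of passes needed to output
-- everything is t + 1: after t+1 passes nothing remains, and after any
-- m ≤ t passes something remains.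
Tier : List ℕ → ℕ → Set
Tier σ t = (leftAfter (suc t) σ ≡ []) × (∀ m → m ≤ t → ¬ (leftAfter m σ ≡ []))

-- IsTau n k : k = τ(n) is the maximum tier over permutations of length n
-- (attained, and an upper bound).
IsTau : ℕ → ℕ → Set
IsTau n k =
  (Data.Product.∃ λ σ → IsPerm n σ × Tier σ k) ×
  (∀ σ t → IsPerm n σ → Tier σ t → t ≤ k)

sumFrom1 : ℕ → (ℕ → ℕ) → ℕ
sumFrom1 zero f = 0
sumFrom1 (suc N) f = sumFrom1 N f + f (suc N)

-- Σ_{j ≥ 1} ⌊(n − 2^{j−1}) / 2^j⌋ with vanishing terms when 2^{j−1} > n;
-- terms with j > n vanish, so summing j = 1..n suffices.
tauSum : ℕ → ℕ
tauSum n = sumFrom1 n (λ j → _/_ (n ∸ 2 ^ (j ∸ 1)) (2 ^ j) {{m^n≢0 2 j}})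

-- Between passes the state is determined by the smallest value k not yet output: a pass from k
-- outputs k, k + 1, …, j − 1 and leaves the values ≥ j in their original order. A pass stops at
-- j ≤ n only if σ contains a pattern j … y … j − 1 with y > j ("j is blocked"), and such a pattern
-- stops every pass started below j by the time it reaches j. The witnesses y of a run of consecutive
-- blocked values a + 1, …, b are distinct and exceed b, so long runs force long jumps later; a
-- potential argument turns this into the upper bound of n − ⌊log₂ n⌋ passes. Conversely,
-- interleaving l, l − 1, …, 1 (l = ⌈n/2⌉) with an extremal permutation of l + 1, …, n blocks
-- 2, …, l together with the shifted blocked values of the smaller permutation; blocked values in
-- increasing order each cost a pass, and there are ⌊(n − 1)/2⌋ + τ(⌊n/2⌋) = n − 1 − ⌊log₂ n⌋ of
-- them. The sum satisfies the same recursion.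

module Submission where

open import Defs
open import Data.Empty using (⊥-elim)
open import Data.List
  using (List; []; _∷_; _++_; _∷ʳ_; [_]; applyUpTo; reverse; map; length; filter)
open import Data.List.Properties
  using ( length-++; length-map; map-upTo; ++-assoc; ++-identityʳ; reverse-++; unfold-reverse; ∷-injectiveˡ
        ; filter-++; filter-all; filter-none; filter-accept; filter-reject)
open import Data.List.Membership.Propositional using (_∈_; _∉_)
open import Data.List.Membership.Propositional.Properties
  using (∈-map⁺; ∈-∃++; ∈-++⁺ˡ; ∈-++⁺ʳ; ∈-++⁻; ∈-filter⁺; ∈-filter⁻)
open import Data.List.Relation.Unary.Any using (here; there)
open import Data.List.Relation.Unary.Any.Properties using (reverse⁺; reverse⁻)
open import Data.List.Relation.Unary.All as All using (All; []; _∷_)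
import Data.List.Relation.Unary.All.Properties as Allₚ
open import Data.List.Relation.Unary.AllPairs using ([]; _∷_)
open import Data.List.Relation.Unary.Unique.Propositional using (Unique)
import Data.List.Relation.Unary.Unique.Propositional.Properties as Unique
open import Data.List.Relation.Binary.Subset.Propositional using (_⊆_)
open import Data.List.Relation.Binary.Permutation.Propositional
  using (_↭_; ↭-refl; ↭-reflexive; ↭-prep; ↭-sym; ↭-trans; ↭⇒↭ₛ; module PermutationReasoning)
open import Data.List.Relation.Binary.Permutation.Propositional.Properties
  using (All-resp-↭; ∈-resp-↭; shift; ∷↭∷ʳ; ++⁺ʳ; ++⁺; map⁺; ↭-length)
import Data.List.Relation.Binary.Permutation.Setoid.Properties as PermSetoid
open import Data.Nat
  using (ℕ; zero; suc; z<s; ⌊_/2⌋; _+_; _*_; _∸_; _^_; _≤_; _<_; z≤n; s≤s; _≤?_; _<?_; pred)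
open import Data.Nat.Properties
open import Data.Nat.DivMod
  using (_/_; m/n<m; m/n*n≤m; 0/n≡0; m/n/o≡m/[n*o]; [m∸n*o]/o≡m/o∸n; /-monoˡ-≤; +-distrib-/-∣ʳ)
open import Data.Nat.Divisibility using (divides)
open import Data.Nat.Logarithm using (⌊log₂_⌋; ⌊log₂[2^n]⌋≡n; ⌊log₂⌊n/2⌋⌋≡⌊log₂n⌋∸1; ⌊log₂⌋-mono-≤)
open import Data.Nat.GeneralisedArithmetic using (fold; iterate; iterate-is-fold)
open import Data.Nat.Induction using (<-rec)
open import Data.Nat.Solver using (module +-*-Solver)
open +-*-Solver using (solve; _:+_; _:*_; _:=_; con)
open import Data.Product using (_×_; _,_; proj₁; proj₂; Σ-syntax)
open import Data.Sum using (inj₁; inj₂)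
open import Data.Unit using (⊤; tt)
open import Function using (_∘_; id)
open import Relation.Nullary using (¬_; yes; no)
open import Relation.Binary.PropositionalEquality
  using (_≡_; _≢_; refl; sym; trans; cong; cong₂; subst; setoid; module ≡-Reasoning)

Unique-resp-↭ : {xs ys : List ℕ} → xs ↭ ys → Unique xs → Unique ys
Unique-resp-↭ p = PermSetoid.Unique-resp-↭ (setoid ℕ) (↭⇒↭ₛ p)

Unique-++⁻ʳ : (xs : List ℕ) {ys : List ℕ} → Unique (xs ++ ys) → Unique ys
Unique-++⁻ʳ []       u       = u
Unique-++⁻ʳ (_ ∷ xs) (_ ∷ u) = Unique-++⁻ʳ xs u

Unique-++⇒∉ : (xs : List ℕ) {ys : List ℕ} {v : ℕ} → Unique (xs ++ ys) → v ∈ xs → v ∉ ys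
Unique-++⇒∉ (_ ∷ xs) (x∉ ∷ _) (here refl) v∈ys = All.lookup x∉ (∈-++⁺ʳ xs v∈ys) refl
Unique-++⇒∉ (_ ∷ xs) (_ ∷ u)  (there v∈xs) v∈ys = Unique-++⇒∉ xs u v∈xs v∈ys

∈-++-∷⁻ : (us : List ℕ) {vs : List ℕ} {x v : ℕ} → v ∈ us ++ x ∷ vs → v ≢ x → v ∈ us ++ vs
∈-++-∷⁻ us v∈ v≢x with ∈-++⁻ us v∈
... | inj₁ v∈us         = ∈-++⁺ˡ v∈us
... | inj₂ (here refl)   = ⊥-elim (v≢x refl)
... | inj₂ (there v∈vs)  = ∈-++⁺ʳ us v∈vs

Unique-⊆⇒length-≤ : {xs ys : List ℕ} → Unique xs → xs ⊆ ys → length xs ≤ length ys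
Unique-⊆⇒length-≤ {[]}     _         _   = z≤n
Unique-⊆⇒length-≤ {x ∷ xs} (x∉ ∷ u) xs⊆ with ∈-∃++ (xs⊆ (here refl))
... | us , vs , refl = begin
  suc (length xs)          ≤⟨ s≤s (Unique-⊆⇒length-≤ u xs⊆us++vs) ⟩
  suc (length (us ++ vs))  ≡⟨ cong suc (length-++ us) ⟩
  suc (length us + length vs) ≡⟨ +-suc (length us) (length vs) ⟨
  length us + length (x ∷ vs) ≡⟨ length-++ us ⟨
  length (us ++ x ∷ vs)    ∎
  where
  open ≤-Reasoning
  xs⊆us++vs : xs ⊆ us ++ vs
  xs⊆us++vs v∈ = ∈-++-∷⁻ us (xs⊆ (there v∈)) (λ v≡x → All.lookup x∉ v∈ (sym v≡x))

data Before (x y : ℕ) : List ℕ → Set where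
  now   : {xs : List ℕ} → y ∈ xs → Before x y (x ∷ xs)
  later : {z : ℕ} {xs : List ℕ} → Before x y xs → Before x y (z ∷ xs)

Before-∈ˡ : {x y : ℕ} {xs : List ℕ} → Before x y xs → x ∈ xs
Before-∈ˡ (now _)   = here refl
Before-∈ˡ (later b) = there (Before-∈ˡ b)

Before-∈ʳ : {x y : ℕ} {xs : List ℕ} → Before x y xs → y ∈ xs
Before-∈ʳ (now y∈)  = there y∈
Before-∈ʳ (later b) = there (Before-∈ʳ b)

Before-trans : {x y z : ℕ} {xs : List ℕ} → Unique xs → Before x y xs → Before y z xs → Before x z xs
Before-trans _       (now _)    (now z∈)   = now z∈
Before-trans _       (now _)    (later yz) = now (Before-∈ʳ yz)
Before-trans u       (later xy) (now _)    = ⊥-elim (Unique.Unique[x∷xs]⇒x∉xs u (Before-∈ʳ xy))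
Before-trans (_ ∷ u) (later xy) (later yz) = later (Before-trans u xy yz)

Before-irrefl : {x : ℕ} {xs : List ℕ} → Unique xs → ¬ Before x x xs
Before-irrefl u       (now x∈)  = Unique.Unique[x∷xs]⇒x∉xs u x∈
Before-irrefl (_ ∷ u) (later b) = Before-irrefl u b

Before-++ˡ : {x y : ℕ} (xs : List ℕ) {ys : List ℕ} → Before x y ys → Before x y (xs ++ ys)
Before-++ˡ []       b = b
Before-++ˡ (_ ∷ xs) b = later (Before-++ˡ xs b)

Before-insert : {x y : ℕ} (xs zs : List ℕ) {ys : List ℕ} → Before x y (xs ++ ys) → Before x y (xs ++ zs ++ ys)
Before-insert []       zs b = Before-++ˡ zs b
Before-insert (_ ∷ xs) zs (now y∈) with ∈-++⁻ xs y∈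
... | inj₁ y∈xs = now (∈-++⁺ˡ y∈xs)
... | inj₂ y∈ys = now (∈-++⁺ʳ xs (∈-++⁺ʳ zs y∈ys))
Before-insert (_ ∷ xs) zs (later b) = later (Before-insert xs zs b)

Before-split : {x z : ℕ} (xs : List ℕ) {ys : List ℕ} → x ∈ xs → Before x z (xs ++ z ∷ ys)
Before-split (_ ∷ xs) (here refl) = now (∈-++⁺ʳ xs (here refl))
Before-split (_ ∷ xs) (there x∈)  = later (Before-split xs x∈)

Before-map⁺ : (f : ℕ → ℕ) {a b : ℕ} {xs : List ℕ} → Before a b xs → Before (f a) (f b) (map f xs)
Before-map⁺ f (now b∈)   = now (∈-map⁺ f b∈)
Before-map⁺ f (later ab) = later (Before-map⁺ f ab)

atLeast : ℕ → List ℕ → List ℕ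
atLeast k = filter (k ≤?_)

atLeast-atLeast : {k j : ℕ} → k ≤ j → (xs : List ℕ) → atLeast j (atLeast k xs) ≡ atLeast j xs
atLeast-atLeast k≤j [] = refl
atLeast-atLeast {k} {j} k≤j (x ∷ xs) with k ≤? x | j ≤? x
... | yes k≤x | yes j≤x
  rewrite filter-accept (k ≤?_) {x} {xs} k≤x | filter-accept (j ≤?_) {x} {atLeast k xs} j≤x
        | filter-accept (j ≤?_) {x} {xs} j≤x = cong (x ∷_) (atLeast-atLeast k≤j xs)
... | yes k≤x | no j≰x
  rewrite filter-accept (k ≤?_) {x} {xs} k≤x | filter-reject (j ≤?_) {x} {atLeast k xs} j≰x
        | filter-reject (j ≤?_) {x} {xs} j≰x = atLeast-atLeast k≤j xs
... | no k≰x | yes j≤x = ⊥-elim (k≰x (≤-trans k≤j j≤x))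
... | no k≰x | no j≰x
  rewrite filter-reject (k ≤?_) {x} {xs} k≰x | filter-reject (j ≤?_) {x} {xs} j≰x = atLeast-atLeast k≤j xs

Before-atLeast⁻ : {k x y : ℕ} (xs : List ℕ) → Before x y (atLeast k xs) → Before x y xs
Before-atLeast⁻ {k} (z ∷ xs) b with k ≤? z
... | yes k≤z rewrite filter-accept (k ≤?_) {z} {xs} k≤z = lemma b
  where
  lemma : Before _ _ (z ∷ atLeast k xs) → Before _ _ (z ∷ xs)
  lemma (now y∈)   = now (proj₁ (∈-filter⁻ (k ≤?_) y∈))
  lemma (later b′) = later (Before-atLeast⁻ xs b′)
... | no k≰z rewrite filter-reject (k ≤?_) {z} {xs} k≰z = later (Before-atLeast⁻ xs b)

Before-atLeast⁺ : {k x y : ℕ} {xs : List ℕ} → k ≤ x → k ≤ y → Before x y xs → Before x y (atLeast k xs)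
Before-atLeast⁺ {k} {xs = z ∷ xs} k≤x k≤y b with k ≤? z
... | yes k≤z rewrite filter-accept (k ≤?_) {z} {xs} k≤z = lemma b
  where
  lemma : Before _ _ (z ∷ xs) → Before _ _ (z ∷ atLeast k xs)
  lemma (now y∈)   = now (∈-filter⁺ (k ≤?_) y∈ k≤y)
  lemma (later b′) = later (Before-atLeast⁺ k≤x k≤y b′)
... | no k≰z rewrite filter-reject (k ≤?_) {z} {xs} k≰z = lemma b
  where
  lemma : Before _ _ (z ∷ xs) → Before _ _ (atLeast k xs)
  lemma (now _)    = ⊥-elim (k≰z k≤x)
  lemma (later b′) = Before-atLeast⁺ k≤x k≤y b′

range : ℕ → ℕ → List ℕ
range k zero    = []
range k (suc d) = k ∷ range (suc k) d

range-≥ : (k d : ℕ) → All (k ≤_) (range k d)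
range-≥ k zero    = []
range-≥ k (suc d) = ≤-refl ∷ All.map <⇒≤ (range-≥ (suc k) d)

range-< : (k d : ℕ) → All (_< d + k) (range k d)
range-< k zero    = []
range-< k (suc d) =
  m<n+m k z<s ∷ subst (λ t → All (_< t) (range (suc k) d)) (+-suc d k) (range-< (suc k) d)

range-last : (k d : ℕ) → d + k ∈ range k (suc d)
range-last k zero    = here refl
range-last k (suc d) = there (subst (_∈ range (suc k) (suc d)) (+-suc d k) (range-last (suc k) d))

range-pred : (k d : ℕ) → k < d + k → pred (d + k) ∈ range k d
range-pred k zero    k<k = ⊥-elim (<-irrefl refl k<k)
range-pred k (suc d) _   = range-last k d

∉range⇒≥ : (k d : ℕ) {v : ℕ} → k ≤ v → v ∉ range k d → d + k ≤ v
∉range⇒≥ k zero    k≤v _ = k≤v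
∉range⇒≥ k (suc d) {v} k≤v v∉ with k ≟ v
... | yes refl = ⊥-elim (v∉ (here refl))
... | no  k≢v  = subst (_≤ v) (+-suc d k) (∉range⇒≥ (suc k) d (≤∧≢⇒< k≤v k≢v) (v∉ ∘ there))

range-unique : (k d : ℕ) → Unique (range k d)
range-unique k zero    = []
range-unique k (suc d) = All.map (λ k<v k≡v → <-irrefl k≡v k<v) (range-≥ (suc k) d) ∷ range-unique (suc k) d

∈-range⁺ : (k d : ℕ) {v : ℕ} → k ≤ v → v < d + k → v ∈ range k d
∈-range⁺ k zero    k≤v v<k = ⊥-elim (<-irrefl refl (≤-<-trans k≤v v<k))
∈-range⁺ k (suc d) {v} k≤v v<d+k with k ≟ v
... | yes refl = here refl
... | no  k≢v  = there (∈-range⁺ (suc k) d (≤∧≢⇒< k≤v k≢v) (subst (v <_) (sym (+-suc d k)) v<d+k))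

length-range : (k d : ℕ) → length (range k d) ≡ d
length-range k zero    = refl
length-range k (suc d) = cong suc (length-range (suc k) d)

range-∷ʳ : (k d : ℕ) → range k (suc d) ≡ range k d ∷ʳ (d + k)
range-∷ʳ k zero    = refl
range-∷ʳ k (suc d) = cong (k ∷_) (trans (range-∷ʳ (suc k) d) (cong (range (suc k) d ∷ʳ_) (+-suc d k)))

range-++ : (k d h : ℕ) → range k d ++ range (d + k) h ≡ range k (d + h)
range-++ k zero    h = refl
range-++ k (suc d) h =
  cong (k ∷_) (trans (cong (λ t → range (suc k) d ++ range t h) (sym (+-suc d k))) (range-++ (suc k) d h))

map-range : (l k h : ℕ) → map (l +_) (range k h) ≡ range (l + k) h
map-range l k zero    = refl
map-range l k (suc h) = cong (l + k ∷_) (trans (map-range l (suc k) h) (cong (λ t → range t h) (+-suc l k)))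

applyUpTo≡range : (k n : ℕ) (f : ℕ → ℕ) → (∀ i → f i ≡ k + i) → applyUpTo f n ≡ range k n
applyUpTo≡range k zero    f f≡ = refl
applyUpTo≡range k (suc n) f f≡ =
  cong₂ _∷_ (trans (f≡ 0) (+-identityʳ k))
            (applyUpTo≡range (suc k) n (f ∘ suc) (λ i → trans (f≡ (suc i)) (+-suc k i)))

down : ℕ → List ℕ
down zero    = []
down (suc l) = suc l ∷ down l

down-↭ : (l : ℕ) → down l ↭ range 1 l
down-↭ zero    = ↭-refl
down-↭ (suc l) = begin
  suc l ∷ down l       ↭⟨ ∷↭∷ʳ (suc l) (down l) ⟩
  down l ∷ʳ suc l      ↭⟨ ++⁺ʳ [ suc l ] (down-↭ l) ⟩
  range 1 l ∷ʳ suc l   ≡⟨ cong (range 1 l ∷ʳ_) (+-comm 1 l) ⟩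
  range 1 l ∷ʳ (l + 1) ≡⟨ range-∷ʳ 1 l ⟨
  range 1 (suc l)      ∎
  where open PermutationReasoning

interleave : List ℕ → List ℕ → List ℕ
interleave []       ys       = ys
interleave (x ∷ xs) []       = x ∷ xs
interleave (x ∷ xs) (y ∷ ys) = x ∷ y ∷ interleave xs ys

interleave-↭ : (xs ys : List ℕ) → interleave xs ys ↭ xs ++ ys
interleave-↭ []       ys       = ↭-refl
interleave-↭ (x ∷ xs) []       = ↭-reflexive (cong (x ∷_) (sym (++-identityʳ xs)))
interleave-↭ (x ∷ xs) (y ∷ ys) = ↭-prep x (↭-trans (↭-prep y (interleave-↭ xs ys)) (↭-sym (shift y xs ys)))

∈-interleave⁺ˡ : (xs ys : List ℕ) {v : ℕ} → v ∈ xs → v ∈ interleave xs ys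
∈-interleave⁺ˡ (x ∷ xs) []       v∈          = v∈
∈-interleave⁺ˡ (x ∷ xs) (y ∷ ys) (here refl) = here refl
∈-interleave⁺ˡ (x ∷ xs) (y ∷ ys) (there v∈)  = there (there (∈-interleave⁺ˡ xs ys v∈))

∈-interleave⁺ʳ : (xs ys : List ℕ) {v : ℕ} → v ∈ ys → v ∈ interleave xs ys
∈-interleave⁺ʳ []       ys       v∈          = v∈
∈-interleave⁺ʳ (x ∷ xs) (y ∷ ys) (here refl) = there (here refl)
∈-interleave⁺ʳ (x ∷ xs) (y ∷ ys) (there v∈)  = there (there (∈-interleave⁺ʳ xs ys v∈))

Before-interleave⁺ʳ : (xs ys : List ℕ) {a b : ℕ} → Before a b ys → Before a b (interleave xs ys)
Before-interleave⁺ʳ []       ys       ab         = ab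
Before-interleave⁺ʳ (x ∷ xs) (y ∷ ys) (now b∈)   = later (now (∈-interleave⁺ʳ xs ys b∈))
Before-interleave⁺ʳ (x ∷ xs) (y ∷ ys) (later ab) = later (later (Before-interleave⁺ʳ xs ys ab))

-- A single pass

TopIsNot : ℕ → List ℕ → Set
TopIsNot k []      = ⊤
TopIsNot k (x ∷ _) = x ≢ k

PopAllView : ℕ → List ℕ → Set
PopAllView k S = Σ[ d ∈ ℕ ] Σ[ S′ ∈ List ℕ ]
  popAll k S ≡ (d + k , S′) × S ≡ range k d ++ S′ × TopIsNot (d + k) S′

popAll-view : (k : ℕ) (S : List ℕ) → PopAllView k S
popAll-view k [] = 0 , [] , refl , refl , tt
popAll-view k (x ∷ S) with x ≟ k
... | no x≢k  = 0 , x ∷ S , refl , refl , x≢k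
... | yes refl with popAll-view (suc k) S
...   | d , S′ , pop≡ , S≡ , top = suc d , S′ , trans pop≡ (cong (_, S′) (+-suc d k)) , cong (x ∷_) S≡ ,
                                 subst (λ t → TopIsNot t S′) (+-suc d k) top

-- Holds of S ++ B, for the stack S and the remaining input B, throughout a pass.
Fresh : ℕ → List ℕ → Set
Fresh k xs = Unique xs × All (k ≤_) xs

pop-↭ : (k d : ℕ) {x : ℕ} {S S′ : List ℕ} (B : List ℕ) →
        x ∷ S ≡ range k d ++ S′ → S ++ x ∷ B ↭ range k d ++ (S′ ++ B)
pop-↭ k d {x} {S} {S′} B S≡ =
  subst (S ++ x ∷ B ↭_) (trans (cong (_++ B) S≡) (++-assoc (range k d) S′ B)) (shift x S B)

Fresh-step : (k d : ℕ) {x : ℕ} {S S′ : List ℕ} (B : List ℕ) →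
             x ∷ S ≡ range k d ++ S′ → Fresh k (S ++ x ∷ B) → Fresh (d + k) (S′ ++ B)
Fresh-step k d B S≡ (u , ≥k) =
  Unique-++⁻ʳ (range k d) u′ ,
  All.tabulate λ v∈ → ∉range⇒≥ k d (All.lookup ≥k′ (∈-++⁺ʳ (range k d) v∈))
                                     (λ v∈r → Unique-++⇒∉ (range k d) u′ v∈r v∈)
  where
  u′ = Unique-resp-↭ (pop-↭ k d B S≡) u
  ≥k′ = All-resp-↭ (pop-↭ k d B S≡) ≥k

∈-step⁻ : (k d : ℕ) {x v : ℕ} {S S′ : List ℕ} (B : List ℕ) → x ∷ S ≡ range k d ++ S′ →
          v ∈ S ++ x ∷ B → d + k ≤ v → v ∈ S′ ++ B
∈-step⁻ k d B S≡ v∈ d+k≤v with ∈-++⁻ (range k d) (∈-resp-↭ (pop-↭ k d B S≡) v∈)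
... | inj₁ v∈r  = ⊥-elim (<⇒≱ (All.lookup (range-< k d) v∈r) d+k≤v)
... | inj₂ v∈S′ = v∈S′

reverse-step : {x : ℕ} {S R S′ : List ℕ} (B : List ℕ) → x ∷ S ≡ R ++ S′ →
               reverse S ++ x ∷ B ≡ reverse S′ ++ (reverse R ++ B)
reverse-step {x} {S} {R} {S′} B S≡ = begin
  reverse S ++ x ∷ B           ≡⟨ ++-assoc (reverse S) [ x ] B ⟨
  (reverse S ++ [ x ]) ++ B    ≡⟨ cong (_++ B) (unfold-reverse x S) ⟨
  reverse (x ∷ S) ++ B         ≡⟨ cong (λ t → reverse t ++ B) S≡ ⟩
  reverse (R ++ S′) ++ B       ≡⟨ cong (_++ B) (reverse-++ R S′) ⟩
  (reverse S′ ++ reverse R) ++ B ≡⟨ ++-assoc (reverse S′) (reverse R) B ⟩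
  reverse S′ ++ (reverse R ++ B) ∎
  where open ≡-Reasoning

passGo-mono : (k : ℕ) (S B : List ℕ) → k ≤ proj₁ (passGo k S B)
passGo-mono k S [] = ≤-refl
passGo-mono k S (x ∷ B) with popAll-view k (x ∷ S)
... | d , S′ , pop≡ , _ , _ rewrite pop≡ = ≤-trans (m≤n+m k d) (passGo-mono (d + k) S′ B)

passGo-remaining : (k : ℕ) (S B : List ℕ) → Fresh k (S ++ B) →
                   proj₂ (passGo k S B) ≡ atLeast (proj₁ (passGo k S B)) (reverse S ++ B)
passGo-remaining k S [] (_ , ≥k) rewrite ++-identityʳ (reverse S) =
  sym (filter-all (k ≤?_) (All.tabulate λ v∈ → All.lookup ≥k (∈-++⁺ˡ {ys = []} (reverse⁻ v∈))))
passGo-remaining k S (x ∷ B) fresh with popAll-view k (x ∷ S)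
... | d , S′ , pop≡ , S≡ , _ rewrite pop≡ = begin
  proj₂ (passGo (d + k) S′ B)                         ≡⟨ passGo-remaining (d + k) S′ B (Fresh-step k d B S≡ fresh) ⟩
  atLeast j (reverse S′ ++ B)                         ≡⟨ filter-++ (j ≤?_) (reverse S′) B ⟩
  atLeast j (reverse S′) ++ atLeast j B               ≡⟨ cong (atLeast j (reverse S′) ++_) popped-gone ⟨
  atLeast j (reverse S′) ++ atLeast j (reverse (range k d) ++ B)
                                                      ≡⟨ filter-++ (j ≤?_) (reverse S′) _ ⟨
  atLeast j (reverse S′ ++ (reverse (range k d) ++ B)) ≡⟨ cong (atLeast j) (reverse-step {R = range k d} B S≡) ⟨
  atLeast j (reverse S ++ x ∷ B)                      ∎
  where
  open ≡-Reasoning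
  j = proj₁ (passGo (d + k) S′ B)
  popped-gone : atLeast j (reverse (range k d) ++ B) ≡ atLeast j B
  popped-gone = trans (filter-++ (j ≤?_) (reverse (range k d)) B)
    (cong (_++ atLeast j B) (filter-none (j ≤?_)
      (All.tabulate λ v∈ → <⇒≱ (<-≤-trans (All.lookup (range-< k d) (reverse⁻ v∈)) (passGo-mono (d + k) S′ B)))))

passGo-progress : (k : ℕ) (S B : List ℕ) → TopIsNot k S → k ∈ B → k < proj₁ (passGo k S B)
passGo-progress k S (x ∷ B) top k∈ with popAll-view k (x ∷ S)
... | suc d , S′ , pop≡ , _ , _ rewrite pop≡ =
  <-≤-trans (m<n+m k z<s) (passGo-mono (suc d + k) S′ B)
... | zero , S′ , pop≡ , refl , top′ rewrite pop≡ with k∈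
...   | here refl = ⊥-elim (top′ refl)
...   | there k∈B = passGo-progress k (x ∷ S) B top′ k∈B

-- The pattern j … y … j − 1 with y > j: when j − 1 arrives, y already sits above j on the stack, so no
-- pass started below j outputs j.
Blocked : List ℕ → ℕ → Set
Blocked σ j = Σ[ y ∈ ℕ ] j < y × Before j y σ × Before y (pred j) σ

stuck-buried : (j : ℕ) (S B : List ℕ) → proj₁ (passGo j S B) ≡ j → TopIsNot j S → All (j ≤_) (S ++ B) →
               j ∈ S ++ B → Σ[ z ∈ ℕ ] Σ[ S′ ∈ List ℕ ] S ≡ z ∷ S′ × j < z × j ∈ S′
stuck-buried j S B stuck top ≥j j∈ with ∈-++⁻ S j∈
... | inj₂ j∈B = ⊥-elim (<-irrefl (sym stuck) (passGo-progress j S B top j∈B))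
stuck-buried j (z ∷ S′) B stuck z≢j (j≤z ∷ _) j∈ | inj₁ (here refl)  = ⊥-elim (z≢j refl)
stuck-buried j (z ∷ S′) B stuck z≢j (j≤z ∷ _) j∈ | inj₁ (there j∈S′) =
  z , S′ , refl , ≤∧≢⇒< j≤z (z≢j ∘ sym) , j∈S′

passGo-stop-Blocked : (k : ℕ) (S B : List ℕ) → Fresh k (S ++ B) → k < proj₁ (passGo k S B) →
                      proj₁ (passGo k S B) ∈ S ++ B → Blocked (reverse S ++ B) (proj₁ (passGo k S B))
passGo-stop-Blocked k S [] _ k<k _ = ⊥-elim (<-irrefl refl k<k)
passGo-stop-Blocked k S (x ∷ B) fresh with popAll-view k (x ∷ S)
... | d , S′ , pop≡ , S≡ , top rewrite pop≡ = blocked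
  where
  j = proj₁ (passGo (d + k) S′ B)
  fresh′ = Fresh-step k d B S≡ fresh
  input≡ : reverse S ++ x ∷ B ≡ reverse S′ ++ (reverse (range k d) ++ B)
  input≡ = reverse-step {R = range k d} B S≡
  lift : {a b : ℕ} → Before a b (reverse S′ ++ B) → Before a b (reverse S ++ x ∷ B)
  lift b = subst (Before _ _) (sym input≡) (Before-insert (reverse S′) (reverse (range k d)) b)
  blocked : k < j → j ∈ S ++ x ∷ B → Blocked (reverse S ++ x ∷ B) j
  blocked k<j j∈ with d + k <? j
  ... | yes d+k<j with passGo-stop-Blocked (d + k) S′ B fresh′ d+k<j (∈-step⁻ k d B S≡ j∈ (<⇒≤ d+k<j))
  ...   | y , j<y , jy , yj-1 = y , j<y , lift jy , lift yj-1
  blocked k<j j∈ | no d+k≮j = subst (Blocked _) d+k≡j (stuck-Blocked (subst (k <_) (sym d+k≡j) k<j))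
    where
    d+k≡j : d + k ≡ j
    d+k≡j = ≤-antisym (passGo-mono (d + k) S′ B) (≮⇒≥ d+k≮j)
    stuck-Blocked : k < d + k → Blocked (reverse S ++ x ∷ B) (d + k)
    stuck-Blocked k<d+k
      with stuck-buried (d + k) S′ B (sym d+k≡j) top (proj₂ fresh′)
             (∈-step⁻ k d B S≡ (subst (_∈ S ++ x ∷ B) (sym d+k≡j) j∈) ≤-refl)
    ... | z , S″ , refl , d+k<z , d+k∈S″ =
      z , d+k<z , subst (Before (d + k) z) (sym input≡′) (Before-split (reverse S″) (reverse⁺ d+k∈S″)) ,
      subst (Before z (pred (d + k))) (sym input≡′)
        (Before-++ˡ (reverse S″) (now (∈-++⁺ˡ (reverse⁺ (range-pred k d k<d+k)))))
      where
      rest = reverse (range k d) ++ B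
      input≡′ : reverse S ++ x ∷ B ≡ reverse S″ ++ z ∷ rest
      input≡′ = trans input≡ (trans (cong (_++ rest) (unfold-reverse z S″)) (++-assoc (reverse S″) [ z ] rest))

Before-range-++ : (k d : ℕ) {x y : ℕ} {T : List ℕ} → All (d + k ≤_) T → x < y →
                  Before y x (range k d ++ T) → Before y x T
Before-range-++ k zero    _  _   b = b
Before-range-++ k (suc d) ≥T x<y (now x∈) with ∈-++⁻ (range (suc k) d) x∈
... | inj₁ x∈r = ⊥-elim (<-asym x<y (All.lookup (range-≥ (suc k) d) x∈r))
... | inj₂ x∈T = ⊥-elim (<-asym x<y (<-≤-trans (m<n+m k z<s) (All.lookup ≥T x∈T)))
Before-range-++ k (suc d) {T = T} ≥T x<y (later b) =
  Before-range-++ (suc k) d (subst (λ t → All (t ≤_) T) (sym (+-suc d k)) ≥T) x<y b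

passGo-≤-buried : (k : ℕ) (S B : List ℕ) {x y : ℕ} → Fresh k (S ++ B) → Before y x S → x < y → k ≤ x →
                  proj₁ (passGo k S B) ≤ x
passGo-≤-buried k S [] _ _ _ k≤x = k≤x
passGo-≤-buried k S (x′ ∷ B) fresh yx x<y k≤x with popAll-view k (x′ ∷ S)
... | d , S′ , pop≡ , S≡ , _ rewrite pop≡ =
  passGo-≤-buried (d + k) S′ B fresh′ yx′ x<y (All.lookup (proj₂ fresh′) (∈-++⁺ˡ (Before-∈ʳ yx′)))
  where
  fresh′ = Fresh-step k d B S≡ fresh
  yx′ = Before-range-++ k d (Allₚ.++⁻ˡ S′ (proj₂ fresh′)) x<y (subst (Before _ _) S≡ (later yx))

passGo-≤-stacked : (k : ℕ) (S B : List ℕ) {x y i : ℕ} → Fresh k (S ++ B) → x ∈ S → Before y i B →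
                   x < y → i < x → proj₁ (passGo k S B) ≤ x
passGo-≤-stacked k S (y ∷ B) fresh x∈S (now i∈B) x<y i<x with popAll-view k (y ∷ S)
... | zero , S′ , pop≡ , S≡ , _ rewrite pop≡ =
  passGo-≤-buried k S′ B (Fresh-step k 0 B S≡ fresh) (subst (Before y _) S≡ (now x∈S)) x<y
    (<⇒≤ (≤-<-trans k≤i i<x))
  where k≤i = All.lookup (proj₂ fresh) (∈-++⁺ʳ S (there i∈B))
... | suc d , S′ , pop≡ , S≡ , _ =
  ⊥-elim (<-irrefl (sym (∷-injectiveˡ S≡)) (<-trans (≤-<-trans k≤i i<x) x<y))
  where k≤i = All.lookup (proj₂ fresh) (∈-++⁺ʳ S (there i∈B))
passGo-≤-stacked k S (x′ ∷ B) fresh x∈S (later yi) x<y i<x with popAll-view k (x′ ∷ S)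
... | d , S′ , pop≡ , S≡ , _ rewrite pop≡ = passGo-≤-stacked (d + k) S′ B fresh′ x∈S′ yi x<y i<x
  where
  fresh′ = Fresh-step k d B S≡ fresh
  d+k≤i = All.lookup (proj₂ fresh′) (∈-++⁺ʳ S′ (Before-∈ʳ yi))
  x∈S′ : _ ∈ S′
  x∈S′ with ∈-++⁻ S′ (∈-step⁻ k d B S≡ (∈-++⁺ˡ x∈S) (<⇒≤ (≤-<-trans d+k≤i i<x)))
  ... | inj₁ x∈ = x∈
  ... | inj₂ x∈B = ⊥-elim (Unique-++⇒∉ S (proj₁ fresh) x∈S (there x∈B))

passGo-≤-pattern : (k : ℕ) (S B : List ℕ) {x y i : ℕ} → Fresh k (S ++ B) → Before x y B → Before y i B →
                   x < y → i < x → proj₁ (passGo k S B) ≤ x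
passGo-≤-pattern k S (x ∷ B) fresh (now _) (now _) x<x _ = ⊥-elim (<-irrefl refl x<x)
passGo-≤-pattern k S (x ∷ B) fresh (now _) (later yi) x<y i<x with popAll-view k (x ∷ S)
... | zero , S′ , pop≡ , S≡ , _ rewrite pop≡ =
  passGo-≤-stacked k S′ B (Fresh-step k 0 B S≡ fresh) (subst (x ∈_) S≡ (here refl)) yi x<y i<x
... | suc d , S′ , pop≡ , S≡ , _ =
  ⊥-elim (<-irrefl (sym (∷-injectiveˡ S≡))
    (≤-<-trans (All.lookup (proj₂ fresh) (∈-++⁺ʳ S (there (Before-∈ʳ yi)))) i<x))
passGo-≤-pattern k S (y ∷ B) fresh (later xy) (now _) _ _ =
  ⊥-elim (Unique.Unique[x∷xs]⇒x∉xs (Unique-++⁻ʳ S (proj₁ fresh)) (Before-∈ʳ xy))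
passGo-≤-pattern k S (x′ ∷ B) fresh (later xy) (later yi) x<y i<x with popAll-view k (x′ ∷ S)
... | d , S′ , pop≡ , S≡ , _ rewrite pop≡ =
  passGo-≤-pattern (d + k) S′ B (Fresh-step k d B S≡ fresh) xy yi x<y i<x

passGo-≤-Blocked : (k : ℕ) (B : List ℕ) {j : ℕ} → Fresh k B → Blocked B j → 0 < j → proj₁ (passGo k [] B) ≤ j
passGo-≤-Blocked k B {suc i} fresh (y , j<y , jy , yi) _ = passGo-≤-pattern k [] B fresh jy yi j<y ≤-refl

iterate-pass-[] : (k q : ℕ) → proj₂ (iterate pass (k , []) q) ≡ []
iterate-pass-[] k zero    = refl
iterate-pass-[] k (suc q) = iterate-pass-[] k q

afterPasses≡iterate : (q : ℕ) (σ : List ℕ) → afterPasses q σ ≡ iterate pass (1 , σ) q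
afterPasses≡iterate q σ = trans (afterPasses≡fold q) (iterate-is-fold (1 , σ) pass q)
  where
  afterPasses≡fold : (q : ℕ) → afterPasses q σ ≡ fold (1 , σ) pass q
  afterPasses≡fold zero    = refl
  afterPasses≡fold (suc q) = cong pass (afterPasses≡fold q)

-- Arithmetic

n<2^n : (n : ℕ) → n < 2 ^ n
n<2^n zero    = z<s
n<2^n (suc n) = begin-strict
  suc n           ≡⟨ +-comm 1 n ⟩
  n + 1           <⟨ +-mono-<-≤ (n<2^n n) (m^n>0 2 n) ⟩
  2 ^ n + 2 ^ n   ≡⟨ cong (2 ^ n +_) (+-identityʳ (2 ^ n)) ⟨
  2 ^ suc n       ∎
  where open ≤-Reasoning

2*n≤2^n : (n : ℕ) → 2 * n ≤ 2 ^ n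
2*n≤2^n zero          = z≤n
2*n≤2^n (suc zero)    = ≤-refl
2*n≤2^n (suc (suc n)) = begin
  2 * suc (suc n)         ≡⟨ *-distribˡ-+ 2 1 (suc n) ⟩
  2 + 2 * suc n           ≤⟨ +-mono-≤ (^-monoʳ-≤ 2 {1} {suc n} (s≤s z≤n)) (2*n≤2^n (suc n)) ⟩
  2 ^ suc n + 2 ^ suc n   ≡⟨ cong (2 ^ suc n +_) (+-identityʳ (2 ^ suc n)) ⟨
  2 ^ suc (suc n)         ∎
  where open ≤-Reasoning

2^c≤s+e⇒c<s : {c s e : ℕ} → 2 ^ c ≤ s + e → e < s → c < s
2^c≤s+e⇒c<s {c} {s} {e} 2^c≤s+e e<s with c <? s
... | yes c<s = c<s
... | no  c≮s = ⊥-elim (<-irrefl refl (begin-strict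
  s + e          <⟨ +-monoʳ-< s e<s ⟩
  s + s          ≡⟨ cong (s +_) (+-identityʳ s) ⟨
  2 * s          ≤⟨ 2*n≤2^n s ⟩
  2 ^ s          ≤⟨ ^-monoʳ-≤ 2 (≮⇒≥ c≮s) ⟩
  2 ^ c          ≤⟨ 2^c≤s+e ⟩
  s + e          ∎))
  where open ≤-Reasoning

+-suc≡⇒≡ : {k s m : ℕ} → k + suc s ≡ suc m → k + s ≡ m
+-suc≡⇒≡ {k} {s} eq = suc-injective (trans (sym (+-suc k s)) eq)

+-suc≡⇒≤ : {k s m : ℕ} → k + suc s ≡ suc m → k ≤ m
+-suc≡⇒≤ {k} {s} eq = ≤-trans (m≤m+n k s) (≤-reflexive (+-suc≡⇒≡ eq))

-- A pass outputting D + 1 ≥ 2 values leaves s values and a blocked run of length 1; the bound of PassBound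
-- then drops by at least one pass.
potential-jump : {D s e c q : ℕ} → 1 ≤ D → e < suc D + s → 2 ^ c ≤ (suc D + s) + e → c + q ≡ suc D + s →
                 Σ[ c′ ∈ ℕ ] Σ[ q′ ∈ ℕ ] 2 ^ c′ ≤ s + 1 × c′ + q′ ≡ s × q′ < q
potential-jump {D} {s} {e} {c} {q} 1≤D e< 2^c≤ c+q≡ with c ≤? D
... | yes c≤D = 0 , s , m≤n+m 1 s , refl ,
  +-cancelˡ-≤ c (suc s) q (≤-trans (+-monoˡ-≤ (suc s) c≤D) (≤-reflexive (trans (+-suc D s) (sym c+q≡))))
... | no c≰D with m≤n⇒∃[o]m+o≡n (<⇒≤ (≰⇒> c≰D))
... | c₀ , refl = c₀ , s ∸ c₀ , 2^c₀≤s+1 , m+[n∸m]≡n c₀≤s , ≤-reflexive (sym q≡)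
  where
  2^c₀≤s+1 : 2 ^ c₀ ≤ s + 1
  2^c₀≤s+1 with 2 ^ c₀ ≤? s + 1
  ... | yes ≤s+1 = ≤s+1
  ... | no  ≰s+1 = ⊥-elim (<-irrefl refl (<-≤-trans (begin-strict
    (suc D + s) + e              <⟨ s≤s (+-monoʳ-≤ (suc D + s) (m<1+n⇒m≤n e<)) ⟩
    suc ((suc D + s) + (D + s))  ≡⟨ solve 2 (λ D s → con 1 :+ ((con 1 :+ D :+ s) :+ (D :+ s))
                                                     := con 2 :* s :+ (con 2 :+ con 2 :* D)) refl D s ⟩
    2 * s + (2 + 2 * D)          ≤⟨ +-mono-≤ (*-monoˡ-≤ s 2≤2^D) (+-mono-≤ 2≤2^D (2*n≤2^n D)) ⟩
    2 ^ D * s + (2 ^ D + 2 ^ D)  ≡⟨ solve 2 (λ p s → p :* s :+ (p :+ p) := p :* (s :+ con 2)) refl (2 ^ D) s ⟩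
    2 ^ D * (s + 2)              ≤⟨ *-monoʳ-≤ (2 ^ D) s+2≤2^c₀ ⟩
    2 ^ D * 2 ^ c₀               ≡⟨ ^-distribˡ-+-* 2 D c₀ ⟨
    2 ^ (D + c₀)                 ∎) 2^c≤))
    where
    open ≤-Reasoning
    2≤2^D : 2 ≤ 2 ^ D
    2≤2^D = ^-monoʳ-≤ 2 1≤D
    s+2≤2^c₀ : s + 2 ≤ 2 ^ c₀
    s+2≤2^c₀ = ≤-trans (≤-reflexive (trans (+-comm s 2) (cong suc (+-comm 1 s)))) (≰⇒> ≰s+1)
  c₀≤s : c₀ ≤ s
  c₀≤s = m<1+n⇒m≤n (≤-trans (n<2^n c₀) (≤-trans 2^c₀≤s+1 (≤-reflexive (+-comm s 1))))
  q≡ : q ≡ suc (s ∸ c₀)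
  q≡ = begin
    q                  ≡⟨ m+n∸m≡n c₀ q ⟨
    c₀ + q ∸ c₀        ≡⟨ cong (_∸ c₀) (+-cancelˡ-≡ D (c₀ + q) (suc s)
                            (trans (sym (+-assoc D c₀ q)) (trans c+q≡ (sym (+-suc D s))))) ⟩
    suc s ∸ c₀         ≡⟨ +-∸-assoc 1 c₀≤s ⟩
    suc (s ∸ c₀)       ∎
    where open ≡-Reasoning

n/2≡⌊n/2⌋ : (n : ℕ) → n / 2 ≡ ⌊ n /2⌋
n/2≡⌊n/2⌋ zero          = refl
n/2≡⌊n/2⌋ (suc zero)    = refl
n/2≡⌊n/2⌋ (suc (suc n)) = begin
  (2 + n) / 2    ≡⟨ cong (_/ 2) (+-comm 2 n) ⟩
  (n + 2) / 2    ≡⟨ +-distrib-/-∣ʳ n (divides 1 refl) ⟩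
  n / 2 + 1      ≡⟨ +-comm (n / 2) 1 ⟩
  suc (n / 2)    ≡⟨ cong suc (n/2≡⌊n/2⌋ n) ⟩
  suc ⌊ n /2⌋    ∎
  where open ≡-Reasoning

n/2+[1+n]/2≡n : (n : ℕ) → n / 2 + suc n / 2 ≡ n
n/2+[1+n]/2≡n n = trans (cong₂ _+_ (n/2≡⌊n/2⌋ n) (n/2≡⌊n/2⌋ (suc n))) (⌊n/2⌋+⌈n/2⌉≡n n)

2≤n⇒1≤n/2 : {n : ℕ} → 2 ≤ n → 1 ≤ n / 2
2≤n⇒1≤n/2 {n} 2≤n = /-monoˡ-≤ {2} {n} 2 2≤n

[1+n]/2≤ : {n f : ℕ} → suc n ≤ suc f → suc n / 2 ≤ f
[1+n]/2≤ {n} 1+n≤1+f = m<1+n⇒m≤n (<-≤-trans (m/n<m (suc n) 2 (s≤s (s≤s z≤n))) 1+n≤1+f)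

maxTier : ℕ → ℕ
maxTier n = n ∸ 1 ∸ ⌊log₂ n ⌋

⌊log₂1⌋≡0 : ⌊log₂ 1 ⌋ ≡ 0
⌊log₂1⌋≡0 = ⌊log₂[2^n]⌋≡n 0

⌊log₂n⌋≡1+⌊log₂n/2⌋ : (n : ℕ) → 2 ≤ n → ⌊log₂ n ⌋ ≡ suc ⌊log₂ (n / 2) ⌋
⌊log₂n⌋≡1+⌊log₂n/2⌋ n 2≤n = begin
  ⌊log₂ n ⌋               ≡⟨ m+[n∸m]≡n 1≤⌊log₂n⌋ ⟨
  suc (⌊log₂ n ⌋ ∸ 1)     ≡⟨ cong suc (⌊log₂⌊n/2⌋⌋≡⌊log₂n⌋∸1 n) ⟨
  suc ⌊log₂ ⌊ n /2⌋ ⌋     ≡⟨ cong (λ t → suc ⌊log₂ t ⌋) (n/2≡⌊n/2⌋ n) ⟨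
  suc ⌊log₂ (n / 2) ⌋     ∎
  where
  open ≡-Reasoning
  1≤⌊log₂n⌋ : 1 ≤ ⌊log₂ n ⌋
  1≤⌊log₂n⌋ = ≤-trans (≤-reflexive (sym (⌊log₂[2^n]⌋≡n 1))) (⌊log₂⌋-mono-≤ 2≤n)

2^⌊log₂n⌋≤n : (n : ℕ) → 1 ≤ n → 2 ^ ⌊log₂ n ⌋ ≤ n
2^⌊log₂n⌋≤n = <-rec (λ n → 1 ≤ n → 2 ^ ⌊log₂ n ⌋ ≤ n) step
  where
  step : (n : ℕ) → ({h : ℕ} → h < n → 1 ≤ h → 2 ^ ⌊log₂ h ⌋ ≤ h) → 1 ≤ n → 2 ^ ⌊log₂ n ⌋ ≤ n
  step (suc zero)    _   _ = ≤-reflexive (cong (2 ^_) ⌊log₂1⌋≡0)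
  step (suc (suc n)) rec _ = begin
    2 ^ ⌊log₂ N ⌋           ≡⟨ cong (2 ^_) (⌊log₂n⌋≡1+⌊log₂n/2⌋ N (s≤s (s≤s z≤n))) ⟩
    2 * 2 ^ ⌊log₂ (N / 2) ⌋ ≤⟨ *-monoʳ-≤ 2 (rec (m/n<m N 2 (s≤s (s≤s z≤n))) (2≤n⇒1≤n/2 {N} 2≤N)) ⟩
    2 * (N / 2)             ≡⟨ *-comm 2 (N / 2) ⟩
    N / 2 * 2               ≤⟨ m/n*n≤m N 2 ⟩
    N                       ∎
    where
    open ≤-Reasoning
    N = suc (suc n)
    2≤N = s≤s (s≤s z≤n)

⌊log₂n⌋<n : (n : ℕ) → 1 ≤ n → ⌊log₂ n ⌋ < n
⌊log₂n⌋<n n 1≤n = <-≤-trans (n<2^n ⌊log₂ n ⌋) (2^⌊log₂n⌋≤n n 1≤n)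

maxTier-rec : (n : ℕ) → maxTier (suc n) ≡ n / 2 + maxTier (suc n / 2)
maxTier-rec zero     = refl
maxTier-rec (suc n) = begin
  suc n ∸ ⌊log₂ N ⌋               ≡⟨ cong (suc n ∸_) (⌊log₂n⌋≡1+⌊log₂n/2⌋ N (s≤s (s≤s z≤n))) ⟩
  suc n ∸ suc ⌊log₂ h ⌋           ≡⟨ cong (_∸ suc ⌊log₂ h ⌋) (n/2+[1+n]/2≡n (suc n)) ⟨
  (A + h) ∸ suc ⌊log₂ h ⌋         ≡⟨ +-∸-assoc A (⌊log₂n⌋<n h (2≤n⇒1≤n/2 {N} (s≤s (s≤s z≤n)))) ⟩
  A + (h ∸ suc ⌊log₂ h ⌋)         ≡⟨ cong (A +_) (∸-+-assoc h 1 ⌊log₂ h ⌋) ⟨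
  A + maxTier h                   ∎
  where
  open ≡-Reasoning
  N = suc (suc n)
  h = N / 2
  A = suc n / 2

n∸⌊log₂n⌋≡1+maxTier : (n : ℕ) → 1 ≤ n → n ∸ ⌊log₂ n ⌋ ≡ suc (maxTier n)
n∸⌊log₂n⌋≡1+maxTier (suc n) 1≤n = +-∸-assoc 1 (m<1+n⇒m≤n (⌊log₂n⌋<n (suc n) 1≤n))

-- Passes over a permutation

BlockedAbove : List ℕ → ℕ → List ℕ → Set
BlockedAbove σ k []       = ⊤
BlockedAbove σ k (b ∷ bs) = k < b × Blocked σ b × BlockedAbove σ b bs

BlockedAbove-≤ : {σ : List ℕ} {k k′ : ℕ} (bs : List ℕ) → k′ ≤ k →
                 BlockedAbove σ k bs → BlockedAbove σ k′ bs
BlockedAbove-≤ []       _    _                    = tt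
BlockedAbove-≤ (_ ∷ _)  k′≤k (k<b , blocked , bs) = ≤-<-trans k′≤k k<b , blocked , bs

module Passes {m : ℕ} {σ : List ℕ} (σ↭ : σ ↭ range 1 m) where

  σ-unique : Unique σ
  σ-unique = Unique-resp-↭ (↭-sym σ↭) (range-unique 1 m)

  ∈σ⇒≤ : {v : ℕ} → v ∈ σ → 1 ≤ v × v ≤ m
  ∈σ⇒≤ {v} v∈ =
    All.lookup (range-≥ 1 m) v∈r , m<1+n⇒m≤n (subst (v <_) (+-comm m 1) (All.lookup (range-< 1 m) v∈r))
    where v∈r = ∈-resp-↭ σ↭ v∈

  ∈σ⁺ : {v : ℕ} → 1 ≤ v → v ≤ m → v ∈ σ
  ∈σ⁺ {v} 1≤v v≤m = ∈-resp-↭ (↭-sym σ↭) (∈-range⁺ 1 m 1≤v (subst (v <_) (+-comm 1 m) (s≤s v≤m)))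

  -- After every pass the input is σ with the values already output deleted.
  state : ℕ → ℕ × List ℕ
  state k = k , atLeast k σ

  next : ℕ → ℕ
  next k = proj₁ (pass (state k))

  fresh : (k : ℕ) → Fresh k (atLeast k σ)
  fresh k = Unique.filter⁺ (k ≤?_) σ-unique , Allₚ.all-filter (k ≤?_) σ

  next-≥ : (k : ℕ) → k ≤ next k
  next-≥ k = passGo-mono k [] (atLeast k σ)

  pass-state : (k : ℕ) → pass (state k) ≡ state (next k)
  pass-state k = cong (next k ,_)
    (trans (passGo-remaining k [] (atLeast k σ) (fresh k)) (atLeast-atLeast (next-≥ k) σ))

  record DoneAfter (q k : ℕ) : Set where
    constructor done
    field remaining≡[] : proj₂ (iterate pass (state k) q) ≡ []

  DoneAfter-suc⁺ : {q k : ℕ} → DoneAfter q (next k) → DoneAfter (suc q) k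
  DoneAfter-suc⁺ {q} {k} (done e) = done (subst (λ st → proj₂ (iterate pass st q) ≡ []) (sym (pass-state k)) e)

  DoneAfter-suc⁻ : {q k : ℕ} → DoneAfter (suc q) k → DoneAfter q (next k)
  DoneAfter-suc⁻ {q} {k} (done e) = done (subst (λ st → proj₂ (iterate pass st q) ≡ []) (pass-state k) e)

  DoneAfter-≤ : {q q′ k : ℕ} → q ≤ q′ → DoneAfter q k → DoneAfter q′ k
  DoneAfter-≤ {q′ = q′} {k} z≤n (done e) =
    done (subst (λ xs → proj₂ (iterate pass (k , xs) q′) ≡ []) (sym e) (iterate-pass-[] k q′))
  DoneAfter-≤ (s≤s q≤q′) d = DoneAfter-suc⁺ (DoneAfter-≤ q≤q′ (DoneAfter-suc⁻ d))

  DoneAfter-zero : {k : ℕ} → m < k → DoneAfter 0 k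
  DoneAfter-zero {k} m<k = done (
    filter-none (k ≤?_) (All.tabulate λ v∈ → <⇒≱ (≤-<-trans (proj₂ (∈σ⇒≤ v∈)) m<k)))

  ∈-state : {k : ℕ} → 1 ≤ k → k ≤ m → k ∈ atLeast k σ
  ∈-state {k} 1≤k k≤m = ∈-filter⁺ (k ≤?_) (∈σ⁺ 1≤k k≤m) ≤-refl

  ¬DoneAfter-zero : {k : ℕ} → 1 ≤ k → k ≤ m → ¬ DoneAfter 0 k
  ¬DoneAfter-zero 1≤k k≤m (done e) with subst (_ ∈_) e (∈-state 1≤k k≤m)
  ... | ()

  next-> : {k : ℕ} → 1 ≤ k → k ≤ m → k < next k
  next-> {k} 1≤k k≤m = passGo-progress k [] (atLeast k σ) tt (∈-state 1≤k k≤m)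

  next-Blocked : {k : ℕ} → 1 ≤ k → k ≤ m → next k ≤ m → Blocked σ (next k)
  next-Blocked {k} 1≤k k≤m j≤m
    with passGo-stop-Blocked k [] (atLeast k σ) (fresh k) (next-> 1≤k k≤m)
           (∈-filter⁺ (k ≤?_) (∈σ⁺ (≤-trans 1≤k (next-≥ k)) j≤m) (next-≥ k))
  ... | y , j<y , jy , yj = y , j<y , Before-atLeast⁻ σ jy , Before-atLeast⁻ σ yj

  next-≤-Blocked : {k j : ℕ} → k < j → Blocked σ j → next k ≤ j
  next-≤-Blocked {k} k<j (y , j<y , jy , yj) =
    passGo-≤-Blocked k (atLeast k σ) (fresh k)
      (y , j<y , Before-atLeast⁺ (<⇒≤ k<j) k≤y jy , Before-atLeast⁺ k≤y (<⇒≤pred k<j) yj) (≤-<-trans z≤n k<j)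
    where k≤y = <⇒≤ (<-trans k<j j<y)

  BlockedRun : ℕ → ℕ → Set
  BlockedRun a b = (j : ℕ) → a < j → j ≤ b → Blocked σ j

  BlockedRun-extend : {a k : ℕ} → BlockedRun a k → Blocked σ (suc k) → BlockedRun a (suc k)
  BlockedRun-extend run blocked j a<j j≤1+k with m≤n⇒m<n∨m≡n j≤1+k
  ... | inj₁ j<1+k = run j a<j (m<1+n⇒m≤n j<1+k)
  ... | inj₂ refl  = blocked

  BlockedRun-tail : {a b : ℕ} → BlockedRun a b → BlockedRun (suc a) b
  BlockedRun-tail {a} run j a+1<j = run j (<-trans (n<1+n a) a+1<j)

  Blocked⇒Before : {j : ℕ} → Blocked σ j → Before j (pred j) σ
  Blocked⇒Before (_ , _ , jy , yj) = Before-trans σ-unique jy yj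

  BlockedRun-Before : {a b : ℕ} → BlockedRun a b → (v : ℕ) → a < v → v ≤ b → Before v a σ
  BlockedRun-Before {a} run (suc v) a<1+v 1+v≤b with a ≟ v
  ... | yes refl = Blocked⇒Before (run (suc v) a<1+v 1+v≤b)
  ... | no  a≢v  = Before-trans σ-unique (Blocked⇒Before (run (suc v) a<1+v 1+v≤b))
                     (BlockedRun-Before run v (≤∧≢⇒< (m<1+n⇒m≤n a<1+v) a≢v) (<⇒≤ 1+v≤b))

  run-witnesses : (e : ℕ) {a b : ℕ} → a + e ≡ b → BlockedRun a b →
                  Σ[ ys ∈ List ℕ ] length ys ≡ e × Unique ys × All (λ y → b < y × Before y a σ) ys
  run-witnesses zero    _ _ = [] , refl , [] , []
  run-witnesses (suc e) {a} {b} a+1+e≡b run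
    with run-witnesses e (trans (sym (+-suc a e)) a+1+e≡b) (BlockedRun-tail run)
  ... | ys , length≡ , ys-unique , ys-ok =
    y ∷ ys , cong suc length≡ , All.tabulate y∉ys ∷ ys-unique ,
    (b<y , ya) ∷ All.map (λ (b<y′ , y′a+1) → b<y′ , Before-trans σ-unique y′a+1 a+1a) ys-ok
    where
    a+1≤b : suc a ≤ b
    a+1≤b = subst (suc a ≤_) a+1+e≡b (≤-trans (m≤m+n (suc a) e) (≤-reflexive (sym (+-suc a e))))
    blocked = run (suc a) (n<1+n a) a+1≤b
    y = proj₁ blocked
    a+1<y = proj₁ (proj₂ blocked)
    a+1y = proj₁ (proj₂ (proj₂ blocked))
    ya = proj₂ (proj₂ (proj₂ blocked))
    a+1a : Before (suc a) a σ
    a+1a = Before-trans σ-unique a+1y ya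
    y∉ys : {y′ : ℕ} → y′ ∈ ys → y ≢ y′
    y∉ys y′∈ refl = Before-irrefl σ-unique (Before-trans σ-unique (proj₂ (All.lookup ys-ok y′∈)) a+1y)
    b<y : b < y
    b<y with b <? y
    ... | yes b<y = b<y
    ... | no  b≮y = ⊥-elim (Before-irrefl σ-unique
                      (Before-trans σ-unique (BlockedRun-Before (BlockedRun-tail run) y a+1<y (≮⇒≥ b≮y)) a+1y))

  run-length : {a e b : ℕ} → a + e ≡ b → b ≤ m → BlockedRun a b → e + b ≤ m
  run-length {a} {e} {b} a+e≡b b≤m run with run-witnesses e a+e≡b run
  ... | ys , length≡ , ys-unique , ys-ok = begin
    e + b                      ≡⟨ cong (_+ b) length≡ ⟨
    length ys + b              ≤⟨ +-monoˡ-≤ b (Unique-⊆⇒length-≤ ys-unique ys⊆) ⟩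
    length (range (suc b) (m ∸ b)) + b ≡⟨ cong (_+ b) (length-range (suc b) (m ∸ b)) ⟩
    m ∸ b + b                  ≡⟨ m∸n+n≡m b≤m ⟩
    m                          ∎
    where
    open ≤-Reasoning
    ys⊆ : ys ⊆ range (suc b) (m ∸ b)
    ys⊆ {y} y∈ = ∈-range⁺ (suc b) (m ∸ b) b<y
               (subst (y <_) (sym (trans (+-suc (m ∸ b) b) (cong suc (m∸n+n≡m b≤m))))
                 (s≤s (proj₂ (∈σ⇒≤ (Before-∈ˡ ya)))))
      where
      b<y = proj₁ (All.lookup ys-ok y∈)
      ya = proj₂ (All.lookup ys-ok y∈)

  run-short : {k s a e : ℕ} → k + suc s ≡ suc m → a + e ≡ k → BlockedRun a k → e < suc s
  run-short {k} {s} {a} {e} k+1+s≡ a+e≡k run =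
    s≤s (+-cancelʳ-≤ k e s (≤-trans (run-length a+e≡k (+-suc≡⇒≤ k+1+s≡) run)
      (≤-reflexive (trans (sym (+-suc≡⇒≡ k+1+s≡)) (+-comm k s)))))

  BlockedRun-single : {j : ℕ} → Blocked σ j → BlockedRun (j ∸ 1) j
  BlockedRun-single {zero}  _       i 0<i i≤0 = ⊥-elim (<⇒≱ 0<i i≤0)
  BlockedRun-single {suc j} blocked i j<i i≤1+j = subst (Blocked σ) (≤-antisym j<i i≤1+j) blocked

  -- With s values left to output and a run of e blocked values ending at the current value k,
  -- s − c more passes suffice whenever 2 ^ c ≤ s + e.
  PassBound : ℕ → Set
  PassBound s = {k a e c q : ℕ} → 1 ≤ k → k + s ≡ suc m → a + e ≡ k → BlockedRun a k →
                2 ^ c ≤ s + e → c + q ≡ s → DoneAfter q k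

  bound-extend : {s k a e c q : ℕ} → PassBound s → 1 ≤ k → k + suc s ≡ suc m → a + e ≡ k → BlockedRun a k →
                 2 ^ c ≤ suc s + e → c + q ≡ s → next k ≤ m → suc k ≡ next k → DoneAfter (suc q) k
  bound-extend {s} {k} {a} {e} {c} {q} bound 1≤k k+1+s≡ a+e≡k run 2^c≤ c+q≡ j≤m 1+k≡j =
    DoneAfter-suc⁺ (subst (DoneAfter q) 1+k≡j
      (bound (s≤s z≤n) (trans (sym (+-suc k s)) k+1+s≡) (trans (+-suc a e) (cong suc a+e≡k))
        (BlockedRun-extend run (subst (Blocked σ) (sym 1+k≡j) (next-Blocked 1≤k k≤m j≤m)))
        (subst (2 ^ c ≤_) (sym (+-suc s e)) 2^c≤) c+q≡))
    where k≤m = +-suc≡⇒≤ k+1+s≡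

  bound-jump : {s k e c q : ℕ} → ({s′ : ℕ} → s′ < suc s → PassBound s′) → 1 ≤ k → k + suc s ≡ suc m →
               e < suc s → 2 ^ c ≤ suc s + e → c + suc q ≡ suc s → next k ≤ m → suc k < next k →
               DoneAfter (suc q) k
  bound-jump {s} {k} {e} {c} {q} bound 1≤k k+1+s≡ e<1+s 2^c≤ c+1+q≡ j≤m 1+k<j =
    finish (potential-jump {suc o} {s″} {e} {c} {suc q} (s≤s z≤n) (subst (e <_) 1+s≡ e<1+s)
              (subst (λ t → 2 ^ c ≤ t + e) 1+s≡ 2^c≤) (trans c+1+q≡ 1+s≡))
    where
    j = next k
    o = proj₁ (m≤n⇒∃[o]m+o≡n 1+k<j)
    2+k+o≡j = proj₂ (m≤n⇒∃[o]m+o≡n 1+k<j)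
    s″ = suc m ∸ j
    j+s″≡ : j + s″ ≡ suc m
    j+s″≡ = m+[n∸m]≡n (≤-trans j≤m (n≤1+n m))
    1+s≡ : suc s ≡ suc (suc o) + s″
    1+s≡ = +-cancelˡ-≡ k (suc s) (suc (suc o) + s″) (begin
      k + suc s               ≡⟨ k+1+s≡ ⟩
      suc m                   ≡⟨ j+s″≡ ⟨
      j + s″                  ≡⟨ cong (_+ s″) 2+k+o≡j ⟨
      suc (suc k) + o + s″    ≡⟨ solve 3 (λ k o s → con 2 :+ k :+ o :+ s := k :+ (con 2 :+ o :+ s)) refl k o s″ ⟩
      k + (suc (suc o) + s″)  ∎)
      where open ≡-Reasoning
    s″<1+s : s″ < suc s
    s″<1+s = subst (s″ <_) (sym 1+s≡) (m<n+m s″ z<s)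
    k≤m = +-suc≡⇒≤ k+1+s≡
    finish : Σ[ c′ ∈ ℕ ] Σ[ q′ ∈ ℕ ] 2 ^ c′ ≤ s″ + 1 × c′ + q′ ≡ s″ × q′ < suc q →
             DoneAfter (suc q) k
    finish (c′ , q′ , 2^c′≤ , c′+q′≡ , q′<1+q) =
      DoneAfter-suc⁺ (DoneAfter-≤ (m<1+n⇒m≤n q′<1+q)
        (bound s″<1+s (≤-trans 1≤k (next-≥ k)) j+s″≡ (m∸n+n≡m (≤-trans (s≤s z≤n) 1+k<j))
          (BlockedRun-single (next-Blocked 1≤k k≤m j≤m)) 2^c′≤ c′+q′≡))

  pass-bound : (s : ℕ) → PassBound s
  pass-bound = <-rec PassBound bound-step
    where
    bound-step : (s : ℕ) → ({s′ : ℕ} → s′ < s → PassBound s′) → PassBound s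
    bound-step zero _ {k} _ k+0≡1+m _ _ _ _ =
      DoneAfter-≤ z≤n (DoneAfter-zero (≤-reflexive (sym (trans (sym (+-identityʳ k)) k+0≡1+m))))
    bound-step (suc s) _ {c = c} {zero} _ k+1+s≡ a+e≡k run 2^c≤ c+0≡1+s =
      ⊥-elim (<-irrefl (trans (sym (+-identityʳ c)) c+0≡1+s) (2^c≤s+e⇒c<s 2^c≤ (run-short k+1+s≡ a+e≡k run)))
    bound-step (suc s) bound {k} {c = c} {suc q} 1≤k k+1+s≡ a+e≡k run 2^c≤ c+1+q≡ with m <? next k
    ... | yes m<j = DoneAfter-≤ (s≤s z≤n) (DoneAfter-suc⁺ (DoneAfter-zero m<j))
    ... | no m≮j with m≤n⇒m<n∨m≡n (next-> 1≤k (+-suc≡⇒≤ k+1+s≡))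
    ...   | inj₂ 1+k≡j = bound-extend (bound (n<1+n s)) 1≤k k+1+s≡ a+e≡k run 2^c≤
                           (suc-injective (trans (sym (+-suc c q)) c+1+q≡)) (≮⇒≥ m≮j) 1+k≡j
    ...   | inj₁ 1+k<j =
      bound-jump bound 1≤k k+1+s≡ (run-short k+1+s≡ a+e≡k run) 2^c≤ c+1+q≡ (≮⇒≥ m≮j) 1+k<j

  2^L≤m⇒DoneAfter-m∸L : {L : ℕ} → 2 ^ L ≤ m → DoneAfter (m ∸ L) 1
  2^L≤m⇒DoneAfter-m∸L {L} 2^L≤m =
    pass-bound m ≤-refl refl refl (λ j 1<j j≤1 → ⊥-elim (<⇒≱ 1<j j≤1))
      (≤-trans 2^L≤m (≤-reflexive (sym (+-identityʳ m)))) (m+[n∸m]≡n (≤-trans (<⇒≤ (n<2^n L)) 2^L≤m))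

  ¬DoneAfter-BlockedAbove : (bs : List ℕ) {k : ℕ} → 1 ≤ k → k ≤ m → BlockedAbove σ k bs →
                            ¬ DoneAfter (length bs) k
  ¬DoneAfter-BlockedAbove []       1≤k k≤m _ = ¬DoneAfter-zero 1≤k k≤m
  ¬DoneAfter-BlockedAbove (b ∷ bs) {k} 1≤k k≤m (k<b , blocked , above) d =
    ¬DoneAfter-BlockedAbove bs (≤-trans 1≤k (next-≥ k)) (≤-trans j≤b b≤m) (BlockedAbove-≤ bs j≤b above)
      (DoneAfter-suc⁻ d)
    where
    j≤b = next-≤-Blocked k<b blocked
    b≤m = proj₂ (∈σ⇒≤ (Before-∈ˡ (proj₁ (proj₂ (proj₂ blocked)))))

  leftAfter≡ : (q : ℕ) → leftAfter q σ ≡ proj₂ (iterate pass (state 1) q)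
  leftAfter≡ q = cong proj₂ (trans (afterPasses≡iterate q σ) (cong (λ xs → iterate pass (1 , xs) q) (sym atLeast-1)))
    where
    atLeast-1 : atLeast 1 σ ≡ σ
    atLeast-1 = filter-all (1 ≤?_) (All.tabulate (proj₁ ∘ ∈σ⇒≤))

  sorted-within : 1 ≤ m → leftAfter (suc (maxTier m)) σ ≡ []
  sorted-within 1≤m = trans (leftAfter≡ (suc (maxTier m)))
    (DoneAfter.remaining≡[] (subst (λ q → DoneAfter q 1) (n∸⌊log₂n⌋≡1+maxTier m 1≤m)
      (2^L≤m⇒DoneAfter-m∸L {⌊log₂ m ⌋} (2^⌊log₂n⌋≤n m 1≤m))))

  Tier-≤ : {t : ℕ} → 1 ≤ m → Tier σ t → t ≤ maxTier m
  Tier-≤ {t} 1≤m (_ , unsorted) with t ≤? maxTier m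
  ... | yes t≤ = t≤
  ... | no  t≰ = ⊥-elim (unsorted (suc (maxTier m)) (≰⇒> t≰) (sorted-within 1≤m))

  unsorted-before : (bs : List ℕ) → 1 ≤ m → BlockedAbove σ 1 bs →
                    (q : ℕ) → q ≤ length bs → ¬ leftAfter q σ ≡ []
  unsorted-before bs 1≤m above q q≤ sorted =
    ¬DoneAfter-BlockedAbove bs ≤-refl 1≤m above (DoneAfter-≤ q≤ (done (trans (sym (leftAfter≡ q)) sorted)))

-- The extremal permutation

Blocked-interleave-down : (l : ℕ) {j : ℕ} (bs : List ℕ) → All (l <_) bs → l ≤ suc (length bs) →
                          1 < j → j ≤ l → Blocked (interleave (down l) bs) j
Blocked-interleave-down zero          _        _ _ 1<j j≤0 = ⊥-elim (<⇒≱ (≤-<-trans z≤n 1<j) j≤0)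
Blocked-interleave-down (suc zero)    []       _ _ 1<j j≤1 = ⊥-elim (<⇒≱ 1<j j≤1)
Blocked-interleave-down (suc (suc l)) []       _ (s≤s ()) _ _
Blocked-interleave-down (suc l) {j} (b ∷ bs) (l<b ∷ l<bs) (s≤s l≤) 1<j j≤1+l with j ≟ suc l
... | yes refl = b , l<b , now (here refl) , later (now (∈-interleave⁺ˡ (down l) bs (top-down 1<j)))
  where
  top-down : 1 < suc l → l ∈ down l
  top-down (s≤s (s≤s _)) = here refl
... | no j≢1+l with Blocked-interleave-down l bs (All.map (<-trans (n<1+n l)) l<bs) l≤ 1<j
                      (m<1+n⇒m≤n (≤∧≢⇒< j≤1+l j≢1+l))
...   | y , j<y , jy , yj = y , j<y , later (later jy) , later (later yj)

Blocked-interleave-map : (xs : List ℕ) (l : ℕ) {ρ : List ℕ} {j : ℕ} → Blocked ρ (suc j) →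
                         Blocked (interleave xs (map (l +_) ρ)) (l + suc j)
Blocked-interleave-map xs l {ρ} {j} (y , j<y , jy , yj) =
  l + y , +-monoʳ-< l j<y , Before-interleave⁺ʳ xs _ (Before-map⁺ (l +_) jy) ,
  subst (λ i → Before (l + y) i (interleave xs (map (l +_) ρ))) (cong pred (sym (+-suc l j)))
    (Before-interleave⁺ʳ xs _ (Before-map⁺ (l +_) yj))

BlockedAbove-map : (xs : List ℕ) (l : ℕ) {ρ : List ℕ} {k : ℕ} (bs : List ℕ) → BlockedAbove ρ k bs →
                   BlockedAbove (interleave xs (map (l +_) ρ)) (l + k) (map (l +_) bs)
BlockedAbove-map xs l []            _                             = tt
BlockedAbove-map xs l (suc b ∷ bs) (k<b , blocked , above) =
  +-monoʳ-< l k<b , Blocked-interleave-map xs l blocked , BlockedAbove-map xs l bs above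

BlockedAbove-range : {σ : List ℕ} (k t : ℕ) {rest : List ℕ} → (∀ j → k < j → j ≤ t + k → Blocked σ j) →
                     BlockedAbove σ (t + k) rest → BlockedAbove σ k (range (suc k) t ++ rest)
BlockedAbove-range k zero    _       above = above
BlockedAbove-range {σ} k (suc t) {rest} blocked above =
  n<1+n k , blocked (suc k) (n<1+n k) (s≤s (m≤n+m k t)) ,
  BlockedAbove-range (suc k) t (λ j 1+k<j j≤ → blocked j (<-trans (n<1+n k) 1+k<j) (subst (j ≤_) (+-suc t k) j≤))
    (subst (λ x → BlockedAbove σ x rest) (sym (+-suc t k)) above)

-- For fuel f ≥ n, extremal f n is a permutation of 1, …, n. For n = 1 + n′ it interleaves l, l − 1, …, 1
-- (l = 1 + ⌊n′/2⌋) with the values above l arranged extremally, which blocks 2, …, l;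
-- extremalBlocked f n lists its blocked values in increasing order.
extremal : ℕ → ℕ → List ℕ
extremal zero    _       = []
extremal (suc f) zero    = []
extremal (suc f) (suc n) = interleave (down (suc (n / 2))) (map (suc (n / 2) +_) (extremal f (suc n / 2)))

extremalBlocked : ℕ → ℕ → List ℕ
extremalBlocked zero    _       = []
extremalBlocked (suc f) zero    = []
extremalBlocked (suc f) (suc n) = range 2 (n / 2) ++ map (suc (n / 2) +_) (extremalBlocked f (suc n / 2))

extremal-↭ : (f n : ℕ) → n ≤ f → extremal f n ↭ range 1 n
extremal-↭ zero    zero    _ = ↭-refl
extremal-↭ (suc f) zero    _ = ↭-refl
extremal-↭ (suc f) (suc n) 1+n≤1+f = begin
  interleave (down l) (map (l +_) (extremal f h)) ↭⟨ interleave-↭ (down l) _ ⟩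
  down l ++ map (l +_) (extremal f h)              ↭⟨ ++⁺ (down-↭ l) (map⁺ (l +_) (extremal-↭ f h h≤f)) ⟩
  range 1 l ++ map (l +_) (range 1 h)              ≡⟨ cong (range 1 l ++_) (map-range l 1 h) ⟩
  range 1 l ++ range (l + 1) h                     ≡⟨ range-++ 1 l h ⟩
  range 1 (l + h)                                  ≡⟨ cong (range 1 ∘ suc) (n/2+[1+n]/2≡n n) ⟩
  range 1 (suc n)                                  ∎
  where
  open PermutationReasoning
  l = suc (n / 2)
  h = suc n / 2
  h≤f = [1+n]/2≤ 1+n≤1+f

extremal-BlockedAbove : (f n : ℕ) → n ≤ f → BlockedAbove (extremal f n) 1 (extremalBlocked f n)
extremal-BlockedAbove zero    zero    _ = tt
extremal-BlockedAbove (suc f) zero    _ = tt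
extremal-BlockedAbove (suc f) (suc n) 1+n≤1+f =
  BlockedAbove-range 1 (n / 2) left-blocked
    (BlockedAbove-≤ _ (n≤1+n _) (BlockedAbove-map (down l) l (extremalBlocked f h) (extremal-BlockedAbove f h h≤f)))
  where
  l = suc (n / 2)
  h = suc n / 2
  h≤f = [1+n]/2≤ 1+n≤1+f
  ρ↭ = extremal-↭ f h h≤f
  l<ρ : All (l <_) (map (l +_) (extremal f h))
  l<ρ = Allₚ.map⁺ (All.map (m<m+n l) (All-resp-↭ (↭-sym ρ↭) (range-≥ 1 h)))
  length-ρ : length (map (l +_) (extremal f h)) ≡ h
  length-ρ = trans (length-map (l +_) (extremal f h)) (trans (↭-length ρ↭) (length-range 1 h))
  left-blocked : (j : ℕ) → 1 < j → j ≤ n / 2 + 1 → Blocked (interleave (down l) (map (l +_) (extremal f h))) j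
  left-blocked j 1<j j≤ = Blocked-interleave-down l _ l<ρ
    (subst (λ t → l ≤ suc t) (sym length-ρ) (s≤s (/-monoˡ-≤ 2 (n≤1+n n))))
    1<j (subst (j ≤_) (+-comm (n / 2) 1) j≤)

length-extremalBlocked : (f n : ℕ) → n ≤ f → length (extremalBlocked f n) ≡ maxTier n
length-extremalBlocked zero    zero    _ = refl
length-extremalBlocked (suc f) zero    _ = refl
length-extremalBlocked (suc f) (suc n) 1+n≤1+f = begin
  length (range 2 (n / 2) ++ map (l +_) (extremalBlocked f h))
    ≡⟨ length-++ (range 2 (n / 2)) ⟩
  length (range 2 (n / 2)) + length (map (l +_) (extremalBlocked f h))
    ≡⟨ cong₂ _+_ (length-range 2 (n / 2)) (trans (length-map (l +_) (extremalBlocked f h))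
                                             (length-extremalBlocked f h ([1+n]/2≤ 1+n≤1+f))) ⟩
  n / 2 + maxTier h
    ≡⟨ maxTier-rec n ⟨
  maxTier (suc n) ∎
  where
  open ≡-Reasoning
  l = suc (n / 2)
  h = suc n / 2

-- The sum formula

tauTerm : ℕ → ℕ → ℕ
tauTerm n j = _/_ (n ∸ 2 ^ (j ∸ 1)) (2 ^ j) {{m^n≢0 2 j}}

sumFrom1-suc : (N : ℕ) (f : ℕ → ℕ) → sumFrom1 (suc N) f ≡ f 1 + sumFrom1 N (f ∘ suc)
sumFrom1-suc zero    f = sym (+-identityʳ (f 1))
sumFrom1-suc (suc N) f = trans (cong (_+ f (suc (suc N))) (sumFrom1-suc N f)) (+-assoc (f 1) _ _)

sumFrom1-cong : (N : ℕ) {f g : ℕ → ℕ} → (∀ j → 1 ≤ j → j ≤ N → f j ≡ g j) →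
                sumFrom1 N f ≡ sumFrom1 N g
sumFrom1-cong zero    _   = refl
sumFrom1-cong (suc N) f≡g =
  cong₂ _+_ (sumFrom1-cong N (λ j 1≤j j≤N → f≡g j 1≤j (≤-trans j≤N (n≤1+n N))))
            (f≡g (suc N) (s≤s z≤n) ≤-refl)

sumFrom1-vanish : {M : ℕ} (N : ℕ) {f : ℕ → ℕ} → M ≤ N → (∀ j → M < j → j ≤ N → f j ≡ 0) →
                  sumFrom1 N f ≡ sumFrom1 M f
sumFrom1-vanish zero z≤n _ = refl
sumFrom1-vanish {M} (suc N) {f} M≤1+N vanish with M ≟ suc N
... | yes refl = refl
... | no  M≢1+N = begin
  sumFrom1 N f + f (suc N) ≡⟨ cong (sumFrom1 N f +_) (vanish (suc N) M<1+N ≤-refl) ⟩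
  sumFrom1 N f + 0         ≡⟨ +-identityʳ _ ⟩
  sumFrom1 N f             ≡⟨ sumFrom1-vanish N (m<1+n⇒m≤n M<1+N)
                                (λ j M<j j≤N → vanish j M<j (≤-trans j≤N (n≤1+n N))) ⟩
  sumFrom1 M f             ∎
  where
  open ≡-Reasoning
  M<1+N = ≤∧≢⇒< M≤1+N M≢1+N

tauTerm-half : (n j : ℕ) → tauTerm n (suc (suc j)) ≡ tauTerm (n / 2) (suc j)
tauTerm-half n j = begin
  _/_ (n ∸ 2 * 2 ^ j) (2 * 2 ^ suc j) {{m^n≢0 2 (suc (suc j))}}
    ≡⟨ m/n/o≡m/[n*o] (n ∸ 2 * 2 ^ j) 2 (2 ^ suc j) {{_}} {{m^n≢0 2 (suc j)}} {{m^n≢0 2 (suc (suc j))}} ⟨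
  _/_ ((n ∸ 2 * 2 ^ j) / 2) (2 ^ suc j) {{m^n≢0 2 (suc j)}}
    ≡⟨ cong (λ t → _/_ t (2 ^ suc j) {{m^n≢0 2 (suc j)}}) half-∸ ⟩
  _/_ (n / 2 ∸ 2 ^ j) (2 ^ suc j) {{m^n≢0 2 (suc j)}} ∎
  where
  open ≡-Reasoning
  half-∸ : (n ∸ 2 * 2 ^ j) / 2 ≡ n / 2 ∸ 2 ^ j
  half-∸ = trans (cong (λ t → (n ∸ t) / 2) (*-comm 2 (2 ^ j))) ([m∸n*o]/o≡m/o∸n n (2 ^ j) 2)

tauTerm-vanish : (n j : ℕ) → n < j → tauTerm n j ≡ 0
tauTerm-vanish n (suc j) n<1+j =
  trans (cong (λ t → _/_ t (2 ^ suc j) {{m^n≢0 2 (suc j)}})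
              (m≤n⇒m∸n≡0 (≤-trans (m<1+n⇒m≤n n<1+j) (<⇒≤ (n<2^n j)))))
        (0/n≡0 (2 ^ suc j) {{m^n≢0 2 (suc j)}})

-- For N = n + 1 the first summand is ⌊n/2⌋ and the (j + 1)-st is the j-th one for ⌊N/2⌋.
tauSum-rec : (n : ℕ) → tauSum (suc n) ≡ n / 2 + tauSum (suc n / 2)
tauSum-rec n = begin
  tauSum (suc n)                                    ≡⟨ sumFrom1-suc n (tauTerm (suc n)) ⟩
  n / 2 + sumFrom1 n (λ j → tauTerm (suc n) (suc j)) ≡⟨ cong (n / 2 +_) (sumFrom1-cong n halved) ⟩
  n / 2 + sumFrom1 n (tauTerm h)                    ≡⟨ cong (n / 2 +_) (sumFrom1-vanish n (m<1+n⇒m≤n h<1+n) vanish) ⟩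
  n / 2 + tauSum h                                  ∎
  where
  open ≡-Reasoning
  h = suc n / 2
  h<1+n = m/n<m (suc n) 2 (s≤s (s≤s z≤n))
  halved : (j : ℕ) → 1 ≤ j → j ≤ n → tauTerm (suc n) (suc j) ≡ tauTerm h j
  halved (suc j) _ _ = tauTerm-half (suc n) j
  vanish : (j : ℕ) → h < j → j ≤ n → tauTerm h j ≡ 0
  vanish j h<j _ = tauTerm-vanish h j h<j

tauSum≡maxTier : (n : ℕ) → tauSum n ≡ maxTier n
tauSum≡maxTier = <-rec (λ n → tauSum n ≡ maxTier n) step
  where
  step : (n : ℕ) → ({h : ℕ} → h < n → tauSum h ≡ maxTier h) → tauSum n ≡ maxTier n
  step zero    _   = refl
  step (suc n) rec = begin
    tauSum (suc n)                ≡⟨ tauSum-rec n ⟩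
    n / 2 + tauSum (suc n / 2)    ≡⟨ cong (n / 2 +_) (rec (m/n<m (suc n) 2 (s≤s (s≤s z≤n)))) ⟩
    n / 2 + maxTier (suc n / 2)   ≡⟨ maxTier-rec n ⟨
    maxTier (suc n)               ∎
    where open ≡-Reasoning

-- The maximum tier

IsPerm≡↭range : {n : ℕ} {σ : List ℕ} → IsPerm n σ ≡ (σ ↭ range 1 n)
IsPerm≡↭range {n} {σ} = cong (σ ↭_) (trans (map-upTo suc n) (applyUpTo≡range 1 n suc (λ _ → refl)))

IsTau-maxTier : (n : ℕ) → 1 ≤ n → IsTau n (maxTier n)
IsTau-maxTier n 1≤n = (extremal n n , σ₀-perm , Extremal.sorted-within 1≤n , unsorted) , bounded
  where
  σ₀↭ = extremal-↭ n n ≤-refl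
  σ₀-perm : IsPerm n (extremal n n)
  σ₀-perm = subst id (sym IsPerm≡↭range) σ₀↭
  module Extremal = Passes σ₀↭
  unsorted : (q : ℕ) → q ≤ maxTier n → ¬ leftAfter q (extremal n n) ≡ []
  unsorted q q≤ = Extremal.unsorted-before (extremalBlocked n n) 1≤n (extremal-BlockedAbove n n ≤-refl) q
                    (subst (q ≤_) (sym (length-extremalBlocked n n ≤-refl)) q≤)
  bounded : (σ : List ℕ) (t : ℕ) → IsPerm n σ → Tier σ t → t ≤ maxTier n
  bounded σ t σ-perm = Passes.Tier-≤ (subst id IsPerm≡↭range σ-perm) 1≤n

IsTau-unique : {n a b : ℕ} → IsTau n a → IsTau n b → a ≡ b
IsTau-unique ((σ , σ-perm , σ-tier) , a-max) ((ρ , ρ-perm , ρ-tier) , b-max) =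
  ≤-antisym (b-max σ _ σ-perm σ-tier) (a-max ρ _ ρ-perm ρ-tier)

theorem3p12 : ((n : ℕ) → 2 ≤ n → (b : ℕ) → IsTau (n / 2) b → IsTau n ((n ∸ 1) / 2 + b))
    × ((n : ℕ) → 1 ≤ n → IsTau n (tauSum n) × (tauSum n ≡ n ∸ 1 ∸ ⌊log₂ n ⌋))
theorem3p12 = τ-rec , τ-closed
  where
  τ-rec : (n : ℕ) → 2 ≤ n → (b : ℕ) → IsTau (n / 2) b → IsTau n ((n ∸ 1) / 2 + b)
  τ-rec n@(suc n′) 2≤n b τ-half = subst (IsTau n) maxTier≡ (IsTau-maxTier n (s≤s z≤n))
    where
    maxTier≡ : maxTier n ≡ n′ / 2 + b
    maxTier≡ = trans (maxTier-rec n′)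
      (cong (n′ / 2 +_) (IsTau-unique (IsTau-maxTier (n / 2) (2≤n⇒1≤n/2 2≤n)) τ-half))
  τ-closed : (n : ℕ) → 1 ≤ n → IsTau n (tauSum n) × (tauSum n ≡ n ∸ 1 ∸ ⌊log₂ n ⌋)
  τ-closed n 1≤n = subst (IsTau n) (sym (tauSum≡maxTier n)) (IsTau-maxTier n 1≤n) , tauSum≡maxTier n
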